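{- Let $G=(V,E)$ be a graph which contains no matching saturating $n$ vertices, and let $v\in V$ be a vertex of degree at least $n-1$ in $G$. Then any graph $G'=(V,E')$ obtained from $G$ by adding further edges incident to $v$ also contains no matching saturating $n$ vertices.
   Context: A matching saturates $n$ vertices if it covers $n$ vertices. -}

module Defs where

open import Data.Nat using (ℕ)
open import Data.Bool using (Bool; true; false)
open import Data.Fin using (Fin)
open import Data.List using (List; []; _∷_; length; filterᵇ; allFin; concatMap)
open import Data.List.Relation.Unary.All using (All)
open import Data.List.Relation.Unary.Unique.Propositional using (Unique)
open import Data.Product using (_×_; _,_; Σ)
open import Relation.Binary.PropositionalEquality using (_≡_)

record Graph (N : ℕ) : Set where
  field
    adj    : Fin N → Fin N → Bool
    sym    : ∀ x y → adj x y ≡ adj y x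
    irrefl : ∀ x → adj x x ≡ false
open Graph public

Edge : ∀ {N} → Graph N → Fin N → Fin N → Set
Edge G x y = adj G x y ≡ true

degree : ∀ {N} → Graph N → Fin N → ℕ
degree {N} G v = length (filterᵇ (adj G v) (allFin N))

endpoints : ∀ {N} → List (Fin N × Fin N) → List (Fin N)
endpoints = concatMap (λ { (x , y) → x ∷ y ∷ [] })

IsMatching : ∀ {N} → Graph N → List (Fin N × Fin N) → Set
IsMatching G M = All (λ { (x , y) → Edge G x y }) M × Unique (endpoints M)

Saturates : ∀ {N} → List (Fin N × Fin N) → ℕ → Set
Saturates M n = length (endpoints M) ≡ n

HasMatchingSaturating : ∀ {N} → Graph N → ℕ → Set
HasMatchingSaturating {N} G n =
  Σ (List (Fin N × Fin N)) λ M → IsMatching G M × Saturates M n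

module Submission where

open import Defs
open import Data.Nat using (ℕ; _≤_; _∸_)
open import Data.Fin using (Fin)
open import Data.Sum using (_⊎_)
open import Relation.Nullary using (¬_)
open import Relation.Binary.PropositionalEquality using (_≡_)

open import Data.Nat using (suc; _<_; s≤s⁻¹)
open import Data.Bool using (true)
import Data.Bool.Properties as Bool
import Data.Fin as Fin
open import Data.List using (List; []; _∷_; _++_; length; filterᵇ; allFin)
open import Data.List.Relation.Unary.All using (All; []; _∷_; all?)
import Data.List.Relation.Unary.All as All
open import Data.List.Relation.Unary.All.Properties using (¬All⇒Any¬; ¬Any⇒All¬; All¬⇒¬Any)
open import Data.List.Relation.Unary.Any using (here; there)
open import Data.List.Relation.Unary.AllPairs using (_∷_)
open import Data.List.Relation.Unary.Unique.Propositional using (Unique)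
import Data.List.Relation.Unary.Unique.Propositional.Properties as Unique
open import Data.List.Membership.Propositional using (_∈_; _∉_; find)
open import Data.List.Membership.Propositional.Properties using (∈-∃++; ∈-filter⁻)
import Data.List.Membership.DecPropositional as DecMembership
open import Data.List.Relation.Binary.Permutation.Propositional
  using (_↭_; prep; swap; trans; ↭⇒↭ₛ) renaming (refl to ↭-refl)
open import Data.List.Relation.Binary.Permutation.Propositional.Properties
  using (All-resp-↭; ∈-resp-↭; ↭-length; shift; shifts)
import Data.List.Relation.Binary.Permutation.Setoid.Properties as SetoidPermutation
open import Data.Product using (_×_; _,_; proj₁; proj₂; ∃; ∃₂)
open import Data.Sum using (inj₁; inj₂)
open import Function using (_∘_; Equivalence)
open import Relation.Nullary using (yes; no; contradiction)
open import Relation.Unary using (Decidable)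
open import Relation.Binary using (DecidableEquality)
open import Relation.Binary.PropositionalEquality using (refl; subst; _≢_; setoid)
  renaming (sym to ≡-sym; trans to ≡-trans)

-- Let M be a matching of G' saturating n vertices.  If every
-- edge of M is an edge of G, M is a matching of G, contradicting the
-- hypothesis.  Otherwise M contains an edge xy that is new, hence incident
-- to v; reordering M we may assume xy is its first edge.  Deleting it leaves a matching M' covering n - 2 vertices and
-- missing v; every edge of M' avoids v and is therefore an old edge, so M'
-- is a matching of G.  Since v has at least n - 1 > n - 2 neighbours in G,
-- by pigeonhole some neighbour w of v is not covered by M', and adding the
-- edge vw to M' gives a matching of G saturating n vertices again — a
-- contradiction.

module _ {a} {A : Set a} where

  ∈⇒↭ : ∀ {x : A} {xs} → x ∈ xs → ∃ λ ys → xs ↭ x ∷ ys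
  ∈⇒↭ {x} x∈xs with ys , zs , refl ← ∈-∃++ x∈xs = ys ++ zs , shift x ys zs

  Unique-↭ : ∀ {xs ys : List A} → xs ↭ ys → Unique xs → Unique ys
  Unique-↭ xs↭ys = SetoidPermutation.Unique-resp-↭ (setoid A) (↭⇒↭ₛ xs↭ys)

  all-or-counterexample : ∀ {p} {P : A → Set p} → Decidable P → ∀ xs →
                          All P xs ⊎ ∃₂ λ x ys → xs ↭ x ∷ ys × ¬ P x
  all-or-counterexample P? xs with all? P? xs
  ... | yes all-P = inj₁ all-P
  ... | no ¬all-P with x , x∈xs , ¬Px ← find (¬All⇒Any¬ P? xs ¬all-P)
                  with ys , xs↭ ← ∈⇒↭ x∈xs = inj₂ (x , ys , xs↭ , ¬Px)

  shorter-remainder : ∀ {x : A} {ys ys′} {k} → ys ↭ x ∷ ys′ →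
                      length ys < suc k → length ys′ < k
  shorter-remainder ys↭ ys<k = s≤s⁻¹ (subst (_< suc _) (↭-length ys↭) ys<k)

  ∉-front : ∀ {x w : A} {ys ys′} → ys ↭ x ∷ ys′ → w ≢ x → w ∉ ys′ → w ∉ ys
  ∉-front ys↭ w≢x w∉ys′ w∈ys with ∈-resp-↭ ys↭ w∈ys
  ... | here w≡x = w≢x w≡x
  ... | there w∈ys′ = w∉ys′ w∈ys′

module _ {a} {A : Set a} (_≟_ : DecidableEquality A) where
  open DecMembership _≟_ using (_∈?_)

  pigeonhole : ∀ {xs ys : List A} → Unique xs → length ys < length xs →
               ∃ λ w → w ∈ xs × w ∉ ys
  pigeonhole {x ∷ xs} {ys} (x≢xs ∷ unique-xs) ys<xs with x ∈? ys
  ... | no x∉ys = x , here refl , x∉ys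
  ... | yes x∈ys with ys′ , ys↭ ← ∈⇒↭ x∈ys
    with w , w∈xs , w∉ys′ ← pigeonhole unique-xs (shorter-remainder ys↭ ys<xs) =
      w , there w∈xs , ∉-front ys↭ (λ w≡x → All.lookup x≢xs w∈xs (≡-sym w≡x)) w∉ys′

module _ {N : ℕ} where

  Pair : Set
  Pair = Fin N × Fin N

  EdgeOf : Graph N → Pair → Set
  EdgeOf H e = Edge H (proj₁ e) (proj₂ e)

  edge? : (H : Graph N) → Decidable (EdgeOf H)
  edge? H e = adj H (proj₁ e) (proj₂ e) Bool.≟ true

  neighbours : Graph N → Fin N → List (Fin N)
  neighbours H v = filterᵇ (adj H v) (allFin N)

  neighbours-unique : (H : Graph N) (v : Fin N) → Unique (neighbours H v)
  neighbours-unique H v = Unique.filter⁺ _ (Unique.allFin⁺ N)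

  ∈-neighbours : (H : Graph N) {v w : Fin N} → w ∈ neighbours H v → Edge H v w
  ∈-neighbours H w∈ = Equivalence.to Bool.T-≡ (proj₂ (∈-filter⁻ (Bool.T? ∘ adj H _) {xs = allFin N} w∈))

  edge-ends-distinct : (H : Graph N) {x y : Fin N} → Edge H x y → x ≢ y
  edge-ends-distinct H {x} xy refl with () ← subst (_≡ true) (irrefl H x) xy

  endpoints-↭ : {M M′ : List Pair} → M ↭ M′ → endpoints M ↭ endpoints M′
  endpoints-↭ ↭-refl = ↭-refl
  endpoints-↭ (prep (x , y) M↭) = prep x (prep y (endpoints-↭ M↭))
  endpoints-↭ (swap (x , y) (x′ , y′) M↭) =
    trans (shifts (x ∷ y ∷ []) (x′ ∷ y′ ∷ []))
          (prep x′ (prep y′ (prep x (prep y (endpoints-↭ M↭)))))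
  endpoints-↭ (trans M↭ M↭′) = trans (endpoints-↭ M↭) (endpoints-↭ M↭′)

  reorder : {H : Graph N} {n : ℕ} {M M′ : List Pair} → M ↭ M′ →
            IsMatching H M × Saturates M n → IsMatching H M′ × Saturates M′ n
  reorder M↭ ((edges , unique) , saturates) =
    (All-resp-↭ M↭ edges , Unique-↭ (endpoints-↭ M↭) unique) ,
    ≡-trans (≡-sym (↭-length (endpoints-↭ M↭))) saturates

  extend : (H : Graph N) (v : Fin N) {M : List Pair} → IsMatching H M →
           v ∉ endpoints M → length (endpoints M) < degree H v →
           ∃ λ w → IsMatching H ((v , w) ∷ M)
  extend H v (edges , unique) v∉M M<deg
    with w , w∈nbrs , w∉M ← pigeonhole Fin._≟_ (neighbours-unique H v) M<deg =
      w , (vw ∷ edges , (edge-ends-distinct H vw ∷ ¬Any⇒All¬ _ v∉M) ∷ ¬Any⇒All¬ _ w∉M ∷ unique)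
    where
    vw : Edge H v w
    vw = ∈-neighbours H w∈nbrs

  NewEdgesAt : Graph N → Graph N → Fin N → Set
  NewEdgesAt G G′ v = ∀ x y → Edge G′ x y → ¬ Edge G x y → x ≡ v ⊎ y ≡ v

  module _ {G G′ : Graph N} {v : Fin N} (new : NewEdgesAt G G′ v) where

    avoiding-v : (M : List Pair) → All (EdgeOf G′) M → v ∉ endpoints M → All (EdgeOf G) M
    avoiding-v [] [] v∉M = []
    avoiding-v ((x , y) ∷ M) (xy′ ∷ edges) v∉M = xy ∷ avoiding-v M edges (v∉M ∘ there ∘ there)
      where
      xy : Edge G x y
      xy with edge? G (x , y)
      ... | yes old = old
      ... | no ¬old with new x y xy′ ¬old
      ...   | inj₁ x≡v = contradiction (here (≡-sym x≡v)) v∉M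
      ...   | inj₂ y≡v = contradiction (there (here (≡-sym y≡v))) v∉M

    drop-new-edge : {x y : Fin N} {M : List Pair} → IsMatching G′ ((x , y) ∷ M) →
                    ¬ Edge G x y → IsMatching G M × v ∉ endpoints M
    drop-new-edge {x} {y} {M} (xy′ ∷ edges , (_ ∷ x∉M) ∷ y∉M ∷ unique) ¬xy =
      (avoiding-v M edges v∉M , unique) , v∉M
      where
      v∉M : v ∉ endpoints M
      v∉M with new x y xy′ ¬xy
      ... | inj₁ refl = All¬⇒¬Any x∉M
      ... | inj₂ refl = All¬⇒¬Any y∉M

fact2p1 : (N n : ℕ) (G G' : Graph N) (v : Fin N)
    → ¬ HasMatchingSaturating G n
    → n ∸ 1 ≤ degree G v
    → (∀ x y → Edge G x y → Edge G' x y)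
    → (∀ x y → Edge G' x y → ¬ Edge G x y → x ≡ v ⊎ y ≡ v)
    → ¬ HasMatchingSaturating G' n
fact2p1 N n G G' v no-matching degree-v _ new (M , matching′)
  with all-or-counterexample (edge? G) M
... | inj₁ all-old = no-matching (M , (all-old , proj₂ (proj₁ matching′)) , proj₂ matching′)
... | inj₂ ((x , y) , M′ , M↭ , ¬xy)
  with matching-xyM′ , saturates ← reorder {H = G'} M↭ matching′
  with matching-M′ , v∉M′ ← drop-new-edge {G = G} {G′ = G'} {v = v} new matching-xyM′ ¬xy
  -- M' covers n - 2 < n - 1 ≤ deg v vertices, so it extends at v.
  with w , matching-vwM′ ← extend G v matching-M′ v∉M′
                             (subst (λ k → k ∸ 1 ≤ degree G v) (≡-sym saturates) degree-v)
  -- Replacing the edge xy by vw does not change the number of covered vertices.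
  = no-matching ((v , w) ∷ M′ , matching-vwM′ , saturates)
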